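{- Let $K$ be an $H$-field, let $\exp\colon K\to K^>$ be an exponential on $K$, and let $\log$ be the compositional inverse of $\exp$. Suppose that $(\exp a)^\dagger=a'$ for all $a\in K$. Then the map $(f,c)\mapsto\exp(c\log f)\colon K^>\times C\to K^>$ is a constant power map on $K$.
   Context: An $H$-field is an ordered differential field $K$ with constant field $C$, viewed as an ordered valued differential field whose valuation ring $\mathcal O$ is the convex hull of $C$, with maximal ideal $\mathfrak o$, such that (H1) $f'>0$ for $f>\mathcal O$ and (H2) $\mathcal O=C+\mathfrak o$. Write $f\sim g$ iff $f-g\prec f$, and $f^\dagger=f'/f$. An exponential on an ordered field $K$ is an ordered group isomorphism $(K,+)\to(K^>,\cdot)$. A constant power map on $K$ is a map $(f,c)\mapsto f^c\colon K^>\times C\to K^>$ such that for $f,g\in K^>$, $c,d\in C$: (C1) $f^cf^d=f^{c+d}$, $(f^c)^d=f^{cd}$, $f^1=f$; (C2) $(fg)^c=f^cg^c$; (C3) $f\sim1\Rightarrow f^c\sim1$; (C4) $(f^c)^\dagger=cf^\dagger$; (C5) $c\mapsto 2^c$ is an ordered group isomorphism $C\to C^>$. -}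

module Defs where

open import Level using (Level; _⊔_; suc)
open import Relation.Binary.PropositionalEquality using (_≡_)
open import Relation.Binary.Core using (Rel)
open import Relation.Binary.Structures using (IsStrictTotalOrder)
open import Algebra.Structures using (IsCommutativeRing)
open import Data.Product using (Σ; ∃; _×_; _,_)
open import Relation.Nullary using (¬_)
open import Data.Sum using (_⊎_)
open import Relation.Binary.Definitions using (tri<; tri≈; tri>)

-- An ordered differential field, with equality = propositional equality.
-- The multiplicative inverse is total with the convention 0⁻¹ = 0
-- (only x⁻¹ for x ≢ 0 is constrained).
record OrderedDifferentialField (a ℓ : Level) : Set (suc (a ⊔ ℓ)) where
  infixl 6 _+_ _-_
  infixl 7 _*_
  infix 4 _<_ _≤_
  field
    Carrier : Set a
    _+_ _*_ : Carrier → Carrier → Carrier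
    -_ : Carrier → Carrier
    _⁻¹ : Carrier → Carrier
    0# 1# : Carrier
    _<_ : Rel Carrier ℓ
    ∂ : Carrier → Carrier
    isCommutativeRing : IsCommutativeRing _≡_ _+_ _*_ -_ 0# 1#
    0≢1 : ¬ (0# ≡ 1#)
    inverseʳ : ∀ x → ¬ (x ≡ 0#) → x * (x ⁻¹) ≡ 1#
    isStrictTotalOrder : IsStrictTotalOrder _≡_ _<_
    +-mono-< : ∀ x y z → x < y → x + z < y + z
    *-pos : ∀ x y → 0# < x → 0# < y → 0# < x * y
    ∂-additive : ∀ x y → ∂ (x + y) ≡ ∂ x + ∂ y
    ∂-leibniz : ∀ x y → ∂ (x * y) ≡ ∂ x * y + x * ∂ y

  _-_ : Carrier → Carrier → Carrier
  x - y = x + (- y)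

  _≤_ : Carrier → Carrier → Set (a ⊔ ℓ)
  x ≤ y = (x < y) ⊎ (x ≡ y)

  ∣_∣ : Carrier → Carrier
  ∣ x ∣ with IsStrictTotalOrder.compare isStrictTotalOrder x 0#
  ... | tri< _ _ _ = - x
  ... | tri≈ _ _ _ = x
  ... | tri> _ _ _ = x

  _† : Carrier → Carrier
  f † = ∂ f * (f ⁻¹)

  IsConst : Carrier → Set a
  IsConst c = ∂ c ≡ 0#

  -- the valuation ring 𝒪 = convex hull of C, and its maximal ideal 𝔬
  In𝒪 : Carrier → Set (a ⊔ ℓ)
  In𝒪 f = Σ Carrier λ c → IsConst c × (∣ f ∣ ≤ c)

  In𝔬 : Carrier → Set (a ⊔ ℓ)
  In𝔬 f = ∀ c → IsConst c → 0# < c → ∣ f ∣ < c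

  _≺_ : Carrier → Carrier → Set (a ⊔ ℓ)
  f ≺ g = ¬ (g ≡ 0#) × In𝔬 (f * (g ⁻¹))

  _∼_ : Carrier → Carrier → Set (a ⊔ ℓ)
  f ∼ g = (f - g) ≺ f

record IsHField {a ℓ : Level} (K : OrderedDifferentialField a ℓ) : Set (a ⊔ ℓ) where
  open OrderedDifferentialField K
  field
    H1 : ∀ f → (∀ g → In𝒪 g → g < f) → 0# < ∂ f
    H2 : ∀ f → In𝒪 f → Σ Carrier λ c → Σ Carrier λ ε → IsConst c × In𝔬 ε × (f ≡ c + ε)

module _ {a ℓ : Level} (K : OrderedDifferentialField a ℓ) where
  open OrderedDifferentialField K

  record IsExponential (exp : Carrier → Carrier) : Set (a ⊔ ℓ) where
    field
      exp-pos : ∀ x → 0# < exp x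
      exp-hom : ∀ x y → exp (x + y) ≡ exp x * exp y
      exp-mono : ∀ x y → x < y → exp x < exp y
      exp-surj : ∀ y → 0# < y → Σ Carrier λ x → exp x ≡ y

  -- constant power map (f , c) ↦ f ^ c : K^> × C → K^>
  -- (pw is given as a total binary function; only its values at
  --  f > 0 and constant c matter)
  record IsConstantPowerMap (pw : Carrier → Carrier → Carrier) : Set (a ⊔ ℓ) where
    two : Carrier
    two = 1# + 1#
    field
      pw-pos : ∀ f c → 0# < f → IsConst c → 0# < pw f c
      C1-add : ∀ f c d → 0# < f → IsConst c → IsConst d →
               pw f c * pw f d ≡ pw f (c + d)
      C1-mul : ∀ f c d → 0# < f → IsConst c → IsConst d →
               pw (pw f c) d ≡ pw f (c * d)
      C1-one : ∀ f → 0# < f → pw f 1# ≡ f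
      C2 : ∀ f g c → 0# < f → 0# < g → IsConst c →
           pw (f * g) c ≡ pw f c * pw g c
      C3 : ∀ f c → 0# < f → IsConst c → f ∼ 1# → pw f c ∼ 1#
      C4 : ∀ f c → 0# < f → IsConst c → (pw f c) † ≡ c * (f †)
      C5-const : ∀ c → IsConst c → IsConst (pw two c)
      C5-hom : ∀ c d → IsConst c → IsConst d → pw two (c + d) ≡ pw two c * pw two d
      C5-mono : ∀ c d → IsConst c → IsConst d → c < d → pw two c < pw two d
      C5-surj : ∀ e → IsConst e → 0# < e → Σ Carrier λ c → IsConst c × (pw two c ≡ e)

{-# OPTIONS --safe #-}
module Submission where

-- Everything is computed in the exponent, log (f ^ c) = c · log f: (C1) and
-- (C2) become ring identities, (C4) is the Leibniz rule for c · log f with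
-- ∂ (log f) = f†, and (C5) holds because exp and log are increasing and, by
-- (exp a)† = a′, map constants to constants.  For (C3), f ∼ 1 means
-- 1 − exp (− log f) ∈ 𝔬, which holds iff log f ∈ 𝔬, since log sends the
-- bounds 1 ± e (e ∈ C>) to constants and exp sends ±e to constants; and 𝔬 is
-- closed under multiplication by constants.

open import Defs
open import Level using (Level; _⊔_)
open import Algebra.Bundles using (CommutativeRing)
import Algebra.Properties.Monoid as MonoidProperties
import Algebra.Properties.Ring as RingProperties
open import Data.Product using (Σ; _×_; _,_; proj₁; proj₂)
open import Relation.Binary.Definitions using (tri<; tri≈; tri>)
open import Relation.Binary.PropositionalEquality
open import Relation.Binary.Structures using (IsStrictTotalOrder)
open import Relation.Nullary using (¬_; contradiction)

module OrderedDifferentialFieldProperties {a ℓ : Level} (K : OrderedDifferentialField a ℓ) where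
  open OrderedDifferentialField K

  commutativeRing : CommutativeRing a a
  commutativeRing = record { isCommutativeRing = isCommutativeRing }

  open CommutativeRing commutativeRing public
    using ( +-assoc; +-comm; +-identityˡ; +-identityʳ; -‿inverseˡ; -‿inverseʳ
          ; *-assoc; *-comm; *-identityˡ; *-identityʳ; distribˡ; distribʳ; zeroˡ; zeroʳ )
  open RingProperties (CommutativeRing.ring commutativeRing) public
    using (-‿involutive; -‿anti-homo-+; -‿distribˡ-*; -‿distribʳ-*; -0#≈0#; ⁻¹-anti-homo‿-; xyx⁻¹≈y; x+x≈x⇒x≈0)
  open IsStrictTotalOrder isStrictTotalOrder public
    using (compare) renaming (trans to <-trans; asym to <-asym; irrefl to <-irrefl)
  open ≡-Reasoning

  private
    module +-Monoid = MonoidProperties (CommutativeRing.+-monoid commutativeRing)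
    module *-Monoid = MonoidProperties (CommutativeRing.*-monoid commutativeRing)

  x-y+y≡x : ∀ x y → x - y + y ≡ x
  x-y+y≡x x y = +-Monoid.cancelʳ (-‿inverseˡ y) x

  x-[x+y]≡-y : ∀ x y → x - (x + y) ≡ - y
  x-[x+y]≡-y x y = begin
    x + - (x + y)    ≡⟨ cong (x +_) (-‿anti-homo-+ x y) ⟩
    x + (- y + - x)  ≡⟨ +-assoc x (- y) (- x) ⟨
    x + - y + - x    ≡⟨ xyx⁻¹≈y x (- y) ⟩
    - y              ∎

  x-[x-y]≡y : ∀ x y → x - (x - y) ≡ y
  x-[x-y]≡y x y = trans (x-[x+y]≡-y x (- y)) (-‿involutive y)

  inverseˡ : ∀ x → ¬ (x ≡ 0#) → x ⁻¹ * x ≡ 1#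
  inverseˡ x x≢0 = trans (*-comm (x ⁻¹) x) (inverseʳ x x≢0)

  x*y⁻¹*y≡x : ∀ x y → ¬ (y ≡ 0#) → x * y ⁻¹ * y ≡ x
  x*y⁻¹*y≡x x y y≢0 = *-Monoid.cancelʳ (inverseˡ y y≢0) x

  ⁻¹-unique : ∀ x y → x * y ≡ 1# → x ⁻¹ ≡ y
  ⁻¹-unique x y xy≡1 = begin
    x ⁻¹            ≡⟨ *-identityʳ (x ⁻¹) ⟨
    x ⁻¹ * 1#       ≡⟨ cong (x ⁻¹ *_) xy≡1 ⟨
    x ⁻¹ * (x * y)  ≡⟨ *-Monoid.cancelˡ (inverseˡ x x≢0) y ⟩
    y               ∎
    where
    x≢0 : ¬ (x ≡ 0#)
    x≢0 x≡0 = 0≢1 (trans (sym (zeroˡ y)) (trans (cong (_* y) (sym x≡0)) xy≡1))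

  [x-1]x⁻¹≡1-x⁻¹ : ∀ x → ¬ (x ≡ 0#) → (x - 1#) * x ⁻¹ ≡ 1# - x ⁻¹
  [x-1]x⁻¹≡1-x⁻¹ x x≢0 = begin
    (x - 1#) * x ⁻¹             ≡⟨ distribʳ (x ⁻¹) x (- 1#) ⟩
    x * x ⁻¹ + - 1# * x ⁻¹      ≡⟨ cong₂ _+_ (inverseʳ x x≢0) (sym (-‿distribˡ-* 1# (x ⁻¹))) ⟩
    1# + - (1# * x ⁻¹)          ≡⟨ cong (λ t → 1# - t) (*-identityˡ (x ⁻¹)) ⟩
    1# - x ⁻¹                   ∎

  0<x⇒x≢0 : ∀ {x} → 0# < x → ¬ (x ≡ 0#)
  0<x⇒x≢0 0<x x≡0 = <-irrefl (sym x≡0) 0<x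

  +-monoʳ-< : ∀ z {x y} → x < y → z + x < z + y
  +-monoʳ-< z {x} {y} x<y = subst₂ _<_ (+-comm x z) (+-comm y z) (+-mono-< x y z x<y)

  x<y⇒0<y-x : ∀ {x y} → x < y → 0# < y - x
  x<y⇒0<y-x {x} {y} x<y = subst (_< y - x) (-‿inverseʳ x) (+-mono-< x y (- x) x<y)

  0<y-x⇒x<y : ∀ {x y} → 0# < y - x → x < y
  0<y-x⇒x<y {x} {y} 0<y-x = subst₂ _<_ (+-identityˡ x) (x-y+y≡x y x) (+-mono-< 0# (y - x) x 0<y-x)

  -‿anti-mono-< : ∀ {x y} → x < y → - y < - x
  -‿anti-mono-< {x} {y} x<y = 0<y-x⇒x<y (subst (0# <_) y-x≡-x-[-y] (x<y⇒0<y-x x<y))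
    where
    y-x≡-x-[-y] : y - x ≡ - x - (- y)
    y-x≡-x-[-y] = trans (+-comm y (- x)) (cong (- x +_) (sym (-‿involutive y)))

  x<0⇒0<-x : ∀ {x} → x < 0# → 0# < - x
  x<0⇒0<-x x<0 = subst (_< _) -0#≈0# (-‿anti-mono-< x<0)

  0<x⇒-x<0 : ∀ {x} → 0# < x → - x < 0#
  0<x⇒-x<0 0<x = subst (_ <_) -0#≈0# (-‿anti-mono-< 0<x)

  sub-anti-mono-< : ∀ z {x y} → x < y → z - y < z - x
  sub-anti-mono-< z x<y = +-monoʳ-< z (-‿anti-mono-< x<y)

  sub-cancel-< : ∀ z {x y} → z - y < z - x → x < y
  sub-cancel-< z {x} {y} z-y<z-x = subst₂ _<_ (x-[x-y]≡y z x) (x-[x-y]≡y z y) (sub-anti-mono-< z z-y<z-x)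

  *-monoʳ-<-pos : ∀ {c x y} → 0# < c → x < y → c * x < c * y
  *-monoʳ-<-pos {c} {x} {y} 0<c x<y = 0<y-x⇒x<y (subst (0# <_) c[y-x]≡cy-cx (*-pos c (y - x) 0<c (x<y⇒0<y-x x<y)))
    where
    c[y-x]≡cy-cx : c * (y - x) ≡ c * y - c * x
    c[y-x]≡cy-cx = trans (distribˡ c y (- x)) (cong (c * y +_) (sym (-‿distribʳ-* c x)))

  0<1 : 0# < 1#
  0<1 with compare 0# 1#
  ... | tri< 0<1 _ _ = 0<1
  ... | tri≈ _ 0≡1 _ = contradiction 0≡1 0≢1
  ... | tri> _ _ 1<0 = contradiction (subst (0# <_) [-1][-1]≡1 (*-pos _ _ 0<-1 0<-1)) (<-asym 1<0)
    where
    0<-1 : 0# < - 1#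
    0<-1 = x<0⇒0<-x 1<0
    [-1][-1]≡1 : - 1# * - 1# ≡ 1#
    [-1][-1]≡1 = begin
      - 1# * - 1#     ≡⟨ -‿distribˡ-* 1# (- 1#) ⟨
      - (1# * - 1#)   ≡⟨ cong -_ (*-identityˡ (- 1#)) ⟩
      - (- 1#)        ≡⟨ -‿involutive 1# ⟩
      1#              ∎

  1<1+x : ∀ {x} → 0# < x → 1# < 1# + x
  1<1+x {x} 0<x = subst (_< 1# + x) (+-identityʳ 1#) (+-monoʳ-< 1# 0<x)

  0<x⁻¹ : ∀ {x} → 0# < x → 0# < x ⁻¹
  0<x⁻¹ {x} 0<x with compare 0# (x ⁻¹)
  ... | tri< 0<x⁻¹ _ _ = 0<x⁻¹
  ... | tri≈ _ 0≡x⁻¹ _ = contradiction (trans (sym (zeroʳ x)) (trans (cong (x *_) 0≡x⁻¹) (inverseʳ x (0<x⇒x≢0 0<x)))) 0≢1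
  ... | tri> _ _ x⁻¹<0 = contradiction (subst (0# <_) x[-x⁻¹]≡-1 (*-pos _ _ 0<x (x<0⇒0<-x x⁻¹<0))) (<-asym (0<x⇒-x<0 0<1))
    where
    x[-x⁻¹]≡-1 : x * - (x ⁻¹) ≡ - 1#
    x[-x⁻¹]≡-1 = trans (sym (-‿distribʳ-* x (x ⁻¹))) (cong -_ (inverseʳ x (0<x⇒x≢0 0<x)))

  ∂-const : ∀ {c} x → IsConst c → ∂ (c * x) ≡ c * ∂ x
  ∂-const {c} x ∂c≡0 = begin
    ∂ (c * x)              ≡⟨ ∂-leibniz c x ⟩
    ∂ c * x + c * ∂ x      ≡⟨ cong (λ t → t * x + c * ∂ x) ∂c≡0 ⟩
    0# * x + c * ∂ x       ≡⟨ cong (_+ c * ∂ x) (zeroˡ x) ⟩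
    0# + c * ∂ x           ≡⟨ +-identityˡ (c * ∂ x) ⟩
    c * ∂ x                ∎

  1-const : IsConst 1#
  1-const = x+x≈x⇒x≈0 (∂ 1#) (begin
    ∂ 1# + ∂ 1#            ≡⟨ cong (_+ ∂ 1#) (*-identityʳ (∂ 1#)) ⟨
    ∂ 1# * 1# + ∂ 1#       ≡⟨ cong (∂ 1# * 1# +_) (*-identityˡ (∂ 1#)) ⟨
    ∂ 1# * 1# + 1# * ∂ 1#  ≡⟨ ∂-leibniz 1# 1# ⟨
    ∂ (1# * 1#)            ≡⟨ cong ∂ (*-identityˡ 1#) ⟩
    ∂ 1#                   ∎)

  +-const : ∀ {c d} → IsConst c → IsConst d → IsConst (c + d)
  +-const {c} {d} ∂c≡0 ∂d≡0 = trans (∂-additive c d) (trans (cong₂ _+_ ∂c≡0 ∂d≡0) (+-identityˡ 0#))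

  *-const : ∀ {c d} → IsConst c → IsConst d → IsConst (c * d)
  *-const {c} {d} ∂c≡0 ∂d≡0 = trans (∂-const d ∂c≡0) (trans (cong (c *_) ∂d≡0) (zeroʳ c))

  0-const : IsConst 0#
  0-const = x+x≈x⇒x≈0 (∂ 0#) (trans (sym (∂-additive 0# 0#)) (cong ∂ (+-identityˡ 0#)))

  -‿const : ∀ {c} → IsConst c → IsConst (- c)
  -‿const {c} ∂c≡0 = begin
    ∂ (- c)          ≡⟨ +-identityʳ (∂ (- c)) ⟨
    ∂ (- c) + 0#     ≡⟨ cong (∂ (- c) +_) ∂c≡0 ⟨
    ∂ (- c) + ∂ c    ≡⟨ ∂-additive (- c) c ⟨
    ∂ (- c + c)      ≡⟨ cong ∂ (-‿inverseˡ c) ⟩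
    ∂ 0#             ≡⟨ 0-const ⟩
    0#               ∎

  ⁻¹-const : ∀ {c} → ¬ (c ≡ 0#) → IsConst c → IsConst (c ⁻¹)
  ⁻¹-const {c} c≢0 ∂c≡0 = begin
    ∂ (c ⁻¹)                  ≡⟨ *-Monoid.cancelˡ (inverseˡ c c≢0) (∂ (c ⁻¹)) ⟨
    c ⁻¹ * (c * ∂ (c ⁻¹))     ≡⟨ cong (c ⁻¹ *_) (∂-const (c ⁻¹) ∂c≡0) ⟨
    c ⁻¹ * ∂ (c * c ⁻¹)       ≡⟨ cong (λ t → c ⁻¹ * ∂ t) (inverseʳ c c≢0) ⟩
    c ⁻¹ * ∂ 1#               ≡⟨ cong (c ⁻¹ *_) 1-const ⟩
    c ⁻¹ * 0#                 ≡⟨ zeroʳ (c ⁻¹) ⟩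
    0#                        ∎

  Infinitesimal : Carrier → Set (a ⊔ ℓ)
  Infinitesimal y = ∀ e → IsConst e → 0# < e → - e < y × y < e

  In𝔬⇒Infinitesimal : ∀ {y} → In𝔬 y → Infinitesimal y
  In𝔬⇒Infinitesimal {y} y∈𝔬 e ∂e≡0 0<e = bounds (y∈𝔬 e ∂e≡0 0<e)
    where
    bounds : ∣ y ∣ < e → - e < y × y < e
    bounds ∣y∣<e with compare y 0#
    ... | tri< y<0 _ _ = subst (- e <_) (-‿involutive y) (-‿anti-mono-< ∣y∣<e) , <-trans y<0 0<e
    ... | tri≈ _ y≡0 _ = subst (- e <_) (sym y≡0) (0<x⇒-x<0 0<e) , ∣y∣<e
    ... | tri> _ _ 0<y = <-trans (0<x⇒-x<0 0<e) 0<y , ∣y∣<e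

  Infinitesimal⇒In𝔬 : ∀ {y} → Infinitesimal y → In𝔬 y
  Infinitesimal⇒In𝔬 {y} y≈0 e ∂e≡0 0<e = bound (y≈0 e ∂e≡0 0<e)
    where
    bound : - e < y × y < e → ∣ y ∣ < e
    bound (-e<y , y<e) with compare y 0#
    ... | tri< _ _ _ = subst (- y <_) (-‿involutive e) (-‿anti-mono-< -e<y)
    ... | tri≈ _ _ _ = y<e
    ... | tri> _ _ _ = y<e

  Infinitesimal-neg : ∀ {y} → Infinitesimal y → Infinitesimal (- y)
  Infinitesimal-neg {y} y≈0 e ∂e≡0 0<e =
    -‿anti-mono-< (proj₂ (y≈0 e ∂e≡0 0<e)) ,
    subst (- y <_) (-‿involutive e) (-‿anti-mono-< (proj₁ (y≈0 e ∂e≡0 0<e)))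

  Infinitesimal-*pos : ∀ {c y} → IsConst c → 0# < c → Infinitesimal y → Infinitesimal (c * y)
  Infinitesimal-*pos {c} {y} ∂c≡0 0<c y≈0 e ∂e≡0 0<e =
    subst (_< c * y) c[-e/c]≡-e (*-monoʳ-<-pos 0<c (proj₁ e/c-bounds)) ,
    subst (c * y <_) c[e/c]≡e (*-monoʳ-<-pos 0<c (proj₂ e/c-bounds))
    where
    c≢0 : ¬ (c ≡ 0#)
    c≢0 = 0<x⇒x≢0 0<c
    e/c-bounds : - (e * c ⁻¹) < y × y < e * c ⁻¹
    e/c-bounds = y≈0 (e * c ⁻¹) (*-const ∂e≡0 (⁻¹-const c≢0 ∂c≡0)) (*-pos e (c ⁻¹) 0<e (0<x⁻¹ 0<c))
    c[e/c]≡e : c * (e * c ⁻¹) ≡ e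
    c[e/c]≡e = trans (*-comm c (e * c ⁻¹)) (x*y⁻¹*y≡x e c c≢0)
    c[-e/c]≡-e : c * - (e * c ⁻¹) ≡ - e
    c[-e/c]≡-e = trans (sym (-‿distribʳ-* c (e * c ⁻¹))) (cong -_ c[e/c]≡e)

  Infinitesimal-*const : ∀ {c y} → IsConst c → Infinitesimal y → Infinitesimal (c * y)
  Infinitesimal-*const {c} {y} ∂c≡0 y≈0 with compare c 0#
  ... | tri< c<0 _ _ = subst Infinitesimal [-c][-y]≡cy (Infinitesimal-*pos (-‿const ∂c≡0) (x<0⇒0<-x c<0) (Infinitesimal-neg y≈0))
    where
    [-c][-y]≡cy : - c * - y ≡ c * y
    [-c][-y]≡cy = begin
      - c * - y       ≡⟨ -‿distribˡ-* c (- y) ⟨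
      - (c * - y)     ≡⟨ cong -_ (-‿distribʳ-* c y) ⟨
      - (- (c * y))   ≡⟨ -‿involutive (c * y) ⟩
      c * y           ∎
  ... | tri≈ _ c≡0 _ = λ e _ 0<e → subst (- e <_) (sym cy≡0) (0<x⇒-x<0 0<e) , subst (_< e) (sym cy≡0) 0<e
    where
    cy≡0 : c * y ≡ 0#
    cy≡0 = trans (cong (_* y) c≡0) (zeroˡ y)
  ... | tri> _ _ 0<c = Infinitesimal-*pos ∂c≡0 0<c y≈0

  ∼1⇒1-⁻¹-Infinitesimal : ∀ {f} → f ∼ 1# → Infinitesimal (1# - f ⁻¹)
  ∼1⇒1-⁻¹-Infinitesimal {f} (f≢0 , [f-1]/f∈𝔬) = In𝔬⇒Infinitesimal (subst In𝔬 ([x-1]x⁻¹≡1-x⁻¹ f f≢0) [f-1]/f∈𝔬)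

  1-⁻¹-Infinitesimal⇒∼1 : ∀ {f} → ¬ (f ≡ 0#) → Infinitesimal (1# - f ⁻¹) → f ∼ 1#
  1-⁻¹-Infinitesimal⇒∼1 {f} f≢0 1-f⁻¹≈0 = f≢0 , subst In𝔬 (sym ([x-1]x⁻¹≡1-x⁻¹ f f≢0)) (Infinitesimal⇒In𝔬 1-f⁻¹≈0)

module _ {a ℓ : Level} (K : OrderedDifferentialField a ℓ) where
  open OrderedDifferentialField K
  open OrderedDifferentialFieldProperties K
  open ≡-Reasoning

  module ExponentialProperties (exp : Carrier → Carrier) (isExponential : IsExponential K exp) where
    open IsExponential isExponential

    exp≢0 : ∀ x → ¬ (exp x ≡ 0#)
    exp≢0 x = 0<x⇒x≢0 (exp-pos x)

    exp-0 : exp 0# ≡ 1#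
    exp-0 = begin
      exp 0#                          ≡⟨ *-identityʳ (exp 0#) ⟨
      exp 0# * 1#                     ≡⟨ cong (exp 0# *_) (inverseʳ (exp 0#) (exp≢0 0#)) ⟨
      exp 0# * (exp 0# * exp 0# ⁻¹)   ≡⟨ *-assoc (exp 0#) (exp 0#) (exp 0# ⁻¹) ⟨
      exp 0# * exp 0# * exp 0# ⁻¹     ≡⟨ cong (_* exp 0# ⁻¹) (exp-hom 0# 0#) ⟨
      exp (0# + 0#) * exp 0# ⁻¹       ≡⟨ cong (λ t → exp t * exp 0# ⁻¹) (+-identityˡ 0#) ⟩
      exp 0# * exp 0# ⁻¹              ≡⟨ inverseʳ (exp 0#) (exp≢0 0#) ⟩
      1#                              ∎

    exp-neg : ∀ x → exp x ⁻¹ ≡ exp (- x)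
    exp-neg x = ⁻¹-unique (exp x) (exp (- x)) (begin
      exp x * exp (- x)   ≡⟨ exp-hom x (- x) ⟨
      exp (x - x)         ≡⟨ cong exp (-‿inverseʳ x) ⟩
      exp 0#              ≡⟨ exp-0 ⟩
      1#                  ∎)

    exp-cancel-< : ∀ {x y} → exp x < exp y → x < y
    exp-cancel-< {x} {y} ex<ey with compare x y
    ... | tri< x<y _ _ = x<y
    ... | tri≈ _ x≡y _ = contradiction ex<ey (<-irrefl (cong exp x≡y))
    ... | tri> _ _ y<x = contradiction (exp-mono y x y<x) (<-asym ex<ey)

    1<exp : ∀ {x} → 0# < x → 1# < exp x
    1<exp {x} 0<x = subst (_< exp x) exp-0 (exp-mono 0# x 0<x)

    exp<1 : ∀ {x} → x < 0# → exp x < 1#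
    exp<1 {x} x<0 = subst (exp x <_) exp-0 (exp-mono x 0# x<0)

  module LogarithmProperties
    (exp log : Carrier → Carrier) (isExponential : IsExponential K exp)
    (log∘exp : ∀ x → log (exp x) ≡ x) (exp∘log : ∀ y → 0# < y → exp (log y) ≡ y) where
    open IsExponential isExponential
    open ExponentialProperties exp isExponential

    log-mul : ∀ {f g} → 0# < f → 0# < g → log (f * g) ≡ log f + log g
    log-mul {f} {g} 0<f 0<g = begin
      log (f * g)                       ≡⟨ cong log (cong₂ _*_ (exp∘log f 0<f) (exp∘log g 0<g)) ⟨
      log (exp (log f) * exp (log g))   ≡⟨ cong log (exp-hom (log f) (log g)) ⟨
      log (exp (log f + log g))         ≡⟨ log∘exp (log f + log g) ⟩
      log f + log g                     ∎

    0<log : ∀ {y} → 1# < y → 0# < log y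
    0<log {y} 1<y = exp-cancel-< (subst₂ _<_ (sym exp-0) (sym (exp∘log y (<-trans 0<1 1<y))) 1<y)

    log<0 : ∀ {y} → 0# < y → y < 1# → log y < 0#
    log<0 {y} 0<y y<1 = exp-cancel-< (subst₂ _<_ (sym (exp∘log y 0<y)) (sym exp-0) y<1)

  module PowerMapProperties
    (exp log : Carrier → Carrier) (isExponential : IsExponential K exp)
    (log∘exp : ∀ x → log (exp x) ≡ x) (exp∘log : ∀ y → 0# < y → exp (log y) ≡ y)
    (exp-† : ∀ x → exp x † ≡ ∂ x) where
    open IsExponential isExponential
    open ExponentialProperties exp isExponential
    open LogarithmProperties exp log isExponential log∘exp exp∘log

    exp-const : ∀ {x} → IsConst x → IsConst (exp x)
    exp-const {x} ∂x≡0 = begin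
      ∂ (exp x)                     ≡⟨ x*y⁻¹*y≡x (∂ (exp x)) (exp x) (exp≢0 x) ⟨
      ∂ (exp x) * exp x ⁻¹ * exp x  ≡⟨ cong (_* exp x) (trans (exp-† x) ∂x≡0) ⟩
      0# * exp x                    ≡⟨ zeroˡ (exp x) ⟩
      0#                            ∎

    ∂log : ∀ {y} → 0# < y → ∂ (log y) ≡ y †
    ∂log {y} 0<y = trans (sym (exp-† (log y))) (cong _† (exp∘log y 0<y))

    log-const : ∀ {y} → 0# < y → IsConst y → IsConst (log y)
    log-const {y} 0<y ∂y≡0 = trans (∂log 0<y) (trans (cong (_* y ⁻¹) ∂y≡0) (zeroˡ (y ⁻¹)))

    exp<1+e : ∀ {y e} → Infinitesimal y → IsConst e → 0# < e → exp y < 1# + e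
    exp<1+e {y} {e} y≈0 ∂e≡0 0<e =
      subst (exp y <_) (exp∘log (1# + e) 0<1+e) (exp-mono y L (proj₂ (y≈0 L ∂L≡0 (0<log (1<1+x 0<e)))))
      where
      0<1+e : 0# < 1# + e
      0<1+e = <-trans 0<1 (1<1+x 0<e)
      L : Carrier
      L = log (1# + e)
      ∂L≡0 : IsConst L
      ∂L≡0 = log-const 0<1+e (+-const 1-const ∂e≡0)

    1-e<exp : ∀ {y e} → Infinitesimal y → IsConst e → 0# < e → 1# - e < exp y
    1-e<exp {y} {e} y≈0 ∂e≡0 0<e with compare 0# (1# - e)
    ... | tri≈ _ 0≡1-e _ = subst (_< exp y) 0≡1-e (exp-pos y)
    ... | tri> _ _ 1-e<0 = <-trans 1-e<0 (exp-pos y)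
    ... | tri< 0<1-e _ _ = subst (_< exp y) (exp∘log (1# - e) 0<1-e) (exp-mono L y L<y)
      where
      L : Carrier
      L = log (1# - e)
      ∂-L≡0 : IsConst (- L)
      ∂-L≡0 = -‿const (log-const 0<1-e (+-const 1-const (-‿const ∂e≡0)))
      0<-L : 0# < - L
      0<-L = x<0⇒0<-x (log<0 0<1-e (subst (1# - e <_) (+-identityʳ 1#) (+-monoʳ-< 1# (0<x⇒-x<0 0<e))))
      L<y : L < y
      L<y = subst (_< y) (-‿involutive L) (proj₁ (y≈0 (- L) ∂-L≡0 0<-L))

    Infinitesimal⇒1-exp-Infinitesimal : ∀ {y} → Infinitesimal y → Infinitesimal (1# - exp y)
    Infinitesimal⇒1-exp-Infinitesimal {y} y≈0 e ∂e≡0 0<e =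
      subst (_< 1# - exp y) (x-[x+y]≡-y 1# e) (sub-anti-mono-< 1# (exp<1+e y≈0 ∂e≡0 0<e)) ,
      subst (1# - exp y <_) (x-[x-y]≡y 1# e) (sub-anti-mono-< 1# (1-e<exp y≈0 ∂e≡0 0<e))

    1-exp-Infinitesimal⇒Infinitesimal : ∀ {y} → Infinitesimal (1# - exp y) → Infinitesimal y
    1-exp-Infinitesimal⇒Infinitesimal {y} 1-exp[y]≈0 e ∂e≡0 0<e = exp-cancel-< exp[-e]<exp[y] , exp-cancel-< exp[y]<exp[e]
      where
      ∂d≡0 : IsConst (1# - exp (- e))
      ∂d≡0 = +-const 1-const (-‿const (exp-const (-‿const ∂e≡0)))
      0<d : 0# < 1# - exp (- e)
      0<d = x<y⇒0<y-x (exp<1 (0<x⇒-x<0 0<e))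
      exp[-e]<exp[y] : exp (- e) < exp y
      exp[-e]<exp[y] = sub-cancel-< 1# (proj₂ (1-exp[y]≈0 (1# - exp (- e)) ∂d≡0 0<d))
      ∂d′≡0 : IsConst (exp e - 1#)
      ∂d′≡0 = +-const (exp-const ∂e≡0) (-‿const 1-const)
      0<d′ : 0# < exp e - 1#
      0<d′ = x<y⇒0<y-x (1<exp 0<e)
      exp[y]<exp[e] : exp y < exp e
      exp[y]<exp[e] = sub-cancel-< 1# (subst (_< 1# - exp y) (⁻¹-anti-homo‿- (exp e) 1#) (proj₁ (1-exp[y]≈0 (exp e - 1#) ∂d′≡0 0<d′)))

    exp∼1⇒Infinitesimal : ∀ {x} → exp x ∼ 1# → Infinitesimal x
    exp∼1⇒Infinitesimal {x} exp[x]∼1 = subst Infinitesimal (-‿involutive x) (Infinitesimal-neg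
      (1-exp-Infinitesimal⇒Infinitesimal (subst (λ t → Infinitesimal (1# - t)) (exp-neg x) (∼1⇒1-⁻¹-Infinitesimal exp[x]∼1))))

    Infinitesimal⇒exp∼1 : ∀ {x} → Infinitesimal x → exp x ∼ 1#
    Infinitesimal⇒exp∼1 {x} x≈0 = 1-⁻¹-Infinitesimal⇒∼1 (exp≢0 x)
      (subst (λ t → Infinitesimal (1# - t)) (sym (exp-neg x)) (Infinitesimal⇒1-exp-Infinitesimal (Infinitesimal-neg x≈0)))

    pow : Carrier → Carrier → Carrier
    pow f c = exp (c * log f)

    pow-+ : ∀ f c d → pow f c * pow f d ≡ pow f (c + d)
    pow-+ f c d = trans (sym (exp-hom (c * log f) (d * log f))) (cong exp (sym (distribʳ (log f) c d)))

    pow-pow : ∀ f c d → pow (pow f c) d ≡ pow f (c * d)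
    pow-pow f c d = cong exp (begin
      d * log (exp (c * log f))   ≡⟨ cong (d *_) (log∘exp (c * log f)) ⟩
      d * (c * log f)             ≡⟨ *-assoc d c (log f) ⟨
      d * c * log f               ≡⟨ cong (_* log f) (*-comm d c) ⟩
      c * d * log f               ∎)

    pow-1 : ∀ {f} → 0# < f → pow f 1# ≡ f
    pow-1 {f} 0<f = trans (cong exp (*-identityˡ (log f))) (exp∘log f 0<f)

    pow-* : ∀ {f g} c → 0# < f → 0# < g → pow (f * g) c ≡ pow f c * pow g c
    pow-* {f} {g} c 0<f 0<g = begin
      exp (c * log (f * g))           ≡⟨ cong (λ t → exp (c * t)) (log-mul 0<f 0<g) ⟩
      exp (c * (log f + log g))       ≡⟨ cong exp (distribˡ c (log f) (log g)) ⟩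
      exp (c * log f + c * log g)     ≡⟨ exp-hom (c * log f) (c * log g) ⟩
      exp (c * log f) * exp (c * log g) ∎

    pow-∼1 : ∀ {f c} → 0# < f → IsConst c → f ∼ 1# → pow f c ∼ 1#
    pow-∼1 {f} 0<f ∂c≡0 f∼1 =
      Infinitesimal⇒exp∼1 (Infinitesimal-*const ∂c≡0 (exp∼1⇒Infinitesimal (subst (_∼ 1#) (sym (exp∘log f 0<f)) f∼1)))

    pow-† : ∀ {f c} → 0# < f → IsConst c → pow f c † ≡ c * f †
    pow-† {f} {c} 0<f ∂c≡0 = begin
      exp (c * log f) †     ≡⟨ exp-† (c * log f) ⟩
      ∂ (c * log f)         ≡⟨ ∂-const (log f) ∂c≡0 ⟩
      c * ∂ (log f)         ≡⟨ cong (c *_) (∂log 0<f) ⟩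
      c * f †               ∎

    pow-const : ∀ {f c} → 0# < f → IsConst f → IsConst c → IsConst (pow f c)
    pow-const 0<f ∂f≡0 ∂c≡0 = exp-const (*-const ∂c≡0 (log-const 0<f ∂f≡0))

    pow-mono : ∀ {f c d} → 1# < f → c < d → pow f c < pow f d
    pow-mono {f} {c} {d} 1<f c<d =
      exp-mono (c * log f) (d * log f) (subst₂ _<_ (*-comm (log f) c) (*-comm (log f) d) (*-monoʳ-<-pos (0<log 1<f) c<d))

    pow-surj : ∀ {f e} → 1# < f → IsConst f → IsConst e → 0# < e → Σ Carrier λ c → IsConst c × (pow f c ≡ e)
    pow-surj {f} {e} 1<f ∂f≡0 ∂e≡0 0<e = log e * log f ⁻¹ , ∂c≡0 , pow[c]≡e
      where
      log[f]≢0 : ¬ (log f ≡ 0#)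
      log[f]≢0 = 0<x⇒x≢0 (0<log 1<f)
      ∂c≡0 : IsConst (log e * log f ⁻¹)
      ∂c≡0 = *-const (log-const 0<e ∂e≡0) (⁻¹-const log[f]≢0 (log-const (<-trans 0<1 1<f) ∂f≡0))
      pow[c]≡e : exp (log e * log f ⁻¹ * log f) ≡ e
      pow[c]≡e = trans (cong exp (x*y⁻¹*y≡x (log e) (log f) log[f]≢0)) (exp∘log e 0<e)

    isConstantPowerMap : IsConstantPowerMap K pow
    isConstantPowerMap = record
      { pw-pos   = λ f c _ _ → exp-pos (c * log f)
      ; C1-add   = λ f c d _ _ _ → pow-+ f c d
      ; C1-mul   = λ f c d _ _ _ → pow-pow f c d
      ; C1-one   = λ f 0<f → pow-1 0<f
      ; C2       = λ f g c 0<f 0<g _ → pow-* c 0<f 0<g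
      ; C3       = λ f c 0<f ∂c≡0 → pow-∼1 0<f ∂c≡0
      ; C4       = λ f c 0<f ∂c≡0 → pow-† 0<f ∂c≡0
      ; C5-const = λ c ∂c≡0 → pow-const 0<2 2-const ∂c≡0
      ; C5-hom   = λ c d _ _ → sym (pow-+ 2# c d)
      ; C5-mono  = λ c d _ _ c<d → pow-mono 1<2 c<d
      ; C5-surj  = λ e ∂e≡0 0<e → pow-surj 1<2 2-const ∂e≡0 0<e
      }
      where
      2# : Carrier
      2# = 1# + 1#
      1<2 : 1# < 2#
      1<2 = 1<1+x 0<1
      0<2 : 0# < 2#
      0<2 = <-trans 0<1 1<2
      2-const : IsConst 2#
      2-const = +-const 1-const 1-const

proposition3p3 : {a ℓ : Level} (K : OrderedDifferentialField a ℓ) → IsHField K →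
                 (exp log : OrderedDifferentialField.Carrier K → OrderedDifferentialField.Carrier K) →
                 IsExponential K exp →
                 (∀ x → log (exp x) ≡ x) →
                 (∀ y → OrderedDifferentialField._<_ K (OrderedDifferentialField.0# K) y → exp (log y) ≡ y) →
                 (∀ x → OrderedDifferentialField._† K (exp x) ≡ OrderedDifferentialField.∂ K x) →
                 IsConstantPowerMap K (λ f c → exp (OrderedDifferentialField._*_ K c (log f)))
proposition3p3 K _ exp log isExponential log∘exp exp∘log exp-† =
  PowerMapProperties.isConstantPowerMap K exp log isExponential log∘exp exp∘log exp-†
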